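{- For every composition $F$ of $I$ and every two-lump composition $(S,T)$ of $I$, the discrete derivative of $\check{\mathtt{c}}_F$ across the special hyperplane $\mathcal H_{(S|T)}$ is \[ \partial_{[S,T]}\check{\mathtt{c}}_F=\mu_{(S|T)}\big(\check{\mathtt{c}}_{F\text{ at }S}\otimes\check{\mathtt{c}}_{F\text{ at }T}-\check{\mathtt{c}}_{F\text{ at' }T}\otimes\check{\mathtt{c}}_{F\text{ at' }S}\big), \] where $\check{\mathtt{c}}_{F\text{ at }S}\otimes\check{\mathtt{c}}_{F\text{ at }T}:=\check{\mathtt{c}}_{F|_S}\otimes\check{\mathtt{c}}_{F|_T}$ if $S$ is a union of an initial segment of lumps of $F$ and $0$ otherwise, and $\check{\mathtt{c}}_{F\text{ at' }T}\otimes\check{\mathtt{c}}_{F\text{ at' }S}:=\check{\mathtt{c}}_{F|_T}\otimes\check{\mathtt{c}}_{F|_S}$ if $T$ is a union of an initial segment of lumps of $F$ and $0$ otherwise.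
   Context: Let $\mathbb{k}$ be a field of characteristic zero and $I$ a finite set. $\mathrm{T}^\vee_I=\{h\in\mathbb{R}I:\sum_ih_i=0\}$; for a two-lump composition $(S,T)$ of $I$ ($S\sqcup T=I$, both nonempty) the special hyperplane is $\mathcal H_{(S|T)}=\{h:\sum_{i\in S}h_i=0\}$, and the adjoint braid arrangement is the set of all special hyperplanes. Its chambers are the adjoint chambers. For a composition $F$ of $I$ (ordered tuple of nonempty disjoint lumps) let $\sigma^\vee_F$ be the cone generated by the coroots $e_{i_1}-e_{i_2}$ for all $i_1\ne i_2$ with the lump of $i_1$ weakly left of that of $i_2$ (a permutohedral tangent cone), and let $\check{\mathtt{c}}_F$ be the function on adjoint chambers taking value $1$ on chambers contained in $\sigma^\vee_F$ and $0$ otherwise (its characteristic functional modulo higher codimensions); $F|_S$ is the restriction of $F$ to $S$. For a codimension-one face $X$ of the arrangement lying in $\mathcal H_{(S|T)}$, let $X^{[S,T]}$ and $X^{[T,S]}$ be the two adjoint chambers with facet $X$, on the sides $\sum_{i\in S}h_i>0$ and $<0$ respectively; the discrete derivative of a function $f$ on adjoint chambers is $\partial_{[S,T]}f(X)=f(X^{[S,T]})-f(X^{[T,S]})$. Under $\mathcal H_{(S|T)}\cong\mathrm{T}^\vee_S\times\mathrm{T}^\vee_T$ each such $X$ lies in a product $C_S\times C_T$ of adjoint chambers over $S$ and over $T$, and $\mu_{(S|T)}(g\otimes g')(X):=g(C_S)g'(C_T)$ for functions $g,g'$ on adjoint chambers over $S$, $T$ (as in Lopez-Norledge-Ocneanu,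 "The Steinmann relations...", Definition 1.6 / 2.3).
   Formalization: Points of the faces and adjoint chambers have rational coordinates rather than real ones, and the cone $\sigma^\vee_F$ is taken with rational coefficients on the coroots. -}

module Defs where

open import Data.Nat using (ℕ; _≤_)
open import Data.Fin using (Fin)
open import Data.Fin.Subset using (Subset; _∈_; _⊆_; _∩_; ∁; ⋃; Nonempty; Empty)
open import Data.Fin.Subset.Properties using (nonempty?)
open import Data.Bool using (Bool; true; false; if_then_else_)
open import Data.Vec using (lookup)
open import Data.List using (List; []; _∷_; length; map; filter; take; foldr; allFin)
import Data.List as L
open import Data.List.Relation.Unary.All using (All)
open import Data.List.Relation.Unary.AllPairs using (AllPairs)
open import Data.Rational using (ℚ; 0ℚ; _+_; _-_; _<_; _≤_)
open import Data.Integer using (ℤ)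
import Data.Integer as ℤ
open import Data.Product using (Σ; ∃; ∃₂; _×_; _,_)
open import Data.Sum using (_⊎_)
open import Relation.Nullary using (¬_)
open import Relation.Binary.PropositionalEquality using (_≡_; _≢_)

-- The finite set I is Fin n.  A vector in ℝI is taken with rational
-- coordinates (every adjoint chamber/face is a relatively open rational
-- polyhedral cone, hence is determined by its rational points).
Vect : ℕ → Set
Vect n = Fin n → ℚ

sumOver : ∀ {n} → Subset n → Vect n → ℚ
sumOver {n} U h = foldr (λ i acc → (if lookup U i then h i else 0ℚ) + acc) 0ℚ (allFin n)

-- restriction of a vector to a subset A (coordinates outside A set to 0);
-- this realises the identification T^∨_A ⊆ ℝI.
restrictV : ∀ {n} → Subset n → Vect n → Vect n
restrictV A h i = if lookup A i then h i else 0ℚ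

InTv : ∀ {n} → Subset n → Vect n → Set
InTv A h = (∀ i → ¬ (i ∈ A) → h i ≡ 0ℚ) × sumOver A h ≡ 0ℚ

-- U is a nonempty proper subset of A, i.e. (U, A∖U) is a two-lump composition of A
ProperSub : ∀ {n} → Subset n → Subset n → Set
ProperSub A U = U ⊆ A × Nonempty U × U ≢ A

-- h lies in some adjoint chamber over A (off every special hyperplane)
Generic : ∀ {n} → Subset n → Vect n → Set
Generic A h = InTv A h × (∀ U → ProperSub A U → sumOver U h ≢ 0ℚ)

SameSign : ℚ → ℚ → Set
SameSign a b = (0ℚ < a × 0ℚ < b) ⊎ (a < 0ℚ × b < 0ℚ) ⊎ (a ≡ 0ℚ × b ≡ 0ℚ)

-- h and h' lie in the same adjoint chamber over A (same sign vector)
SameChamber : ∀ {n} → Subset n → Vect n → Vect n → Set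
SameChamber A h h' = Generic A h × Generic A h' ×
  (∀ U → ProperSub A U → SameSign (sumOver U h) (sumOver U h'))

IsComposition : ∀ {n} → Subset n → List (Subset n) → Set
IsComposition A F =
  All Nonempty F × AllPairs (λ B C → Empty (B ∩ C)) F × ⋃ F ≡ A

restrictC : ∀ {n} → Subset n → List (Subset n) → List (Subset n)
restrictC S F = filter nonempty? (map (λ B → B ∩ S) F)

WeaklyLeft : ∀ {n} → List (Subset n) → Fin n → Fin n → Set
WeaklyLeft F i j = Σ (Fin (length F)) λ p → Σ (Fin (length F)) λ q →
  Data.Fin._≤_ p q × i ∈ L.lookup F p × j ∈ L.lookup F q

-- h ∈ σ^∨_F : h = Σ c_{ij} (e_i - e_j), c_{ij} ≥ 0, c_{ij} ≠ 0 only if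
-- i ≠ j and the lump of i is weakly left of the lump of j.
InCone : ∀ {n} → List (Subset n) → Vect n → Set
InCone {n} F h = Σ (Fin n → Fin n → ℚ) λ c →
  (∀ i j → 0ℚ Data.Rational.≤ c i j) ×
  (∀ i j → c i j ≢ 0ℚ → i ≢ j × WeaklyLeft F i j) ×
  (∀ m → h m ≡ foldr (λ j acc → c m j + acc) 0ℚ (allFin n)
               - foldr (λ i acc → c i m + acc) 0ℚ (allFin n))

ChamberInCone : ∀ {n} → Subset n → List (Subset n) → Vect n → Set
ChamberInCone A F h = ∀ h' → SameChamber A h h' → InCone F h'

-- v is the value of the indicator of P (in ℤ ⊆ 𝕜)
IsIndicator : Set → ℤ → Set
IsIndicator P v = (P × v ≡ ℤ.+ 1) ⊎ (¬ P × v ≡ ℤ.+ 0)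

InitialSeg : ∀ {n} → List (Subset n) → Subset n → Set
InitialSeg F S = Σ ℕ λ m → m Data.Nat.≤ length F × ⋃ (take m F) ≡ S

-- x is a point of a codimension-one face X of the adjoint braid arrangement
-- (over I = ⊤) lying in H_(S|∁S)
FacePoint : ∀ {n} → Subset n → Subset n → Vect n → Set
FacePoint I S x = InTv I x × sumOver S x ≡ 0ℚ ×
  (∀ U → ProperSub I U → U ≢ S → U ≢ ∁ S → sumOver U x ≢ 0ℚ)

-- h lies in the adjoint chamber X^[S,T] having the face X of x as a facet,
-- on the side Σ_S h > 0 (face relation via sign vectors)
ChamberAbove : ∀ {n} → Subset n → Subset n → Vect n → Vect n → Set
ChamberAbove I S x h = Generic I h × 0ℚ < sumOver S h ×
  (∀ U → ProperSub I U → U ≢ S → U ≢ ∁ S → SameSign (sumOver U x) (sumOver U h))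

module Submission where

-- Write Prefix≥0 F h for: the sum of h over every union of an initial segment of lumps
-- of F is nonnegative.  The proof rests on four facts.
--  (1) Cone criterion.  A zero-sum vector supported on the lumps of F lies in σ^∨_F iff
--      Prefix≥0 F h.  (⇒: a flow along coroots e_i - e_j, i weakly left of j, never
--      removes mass from a prefix.  ⇐: induction on the lumps, transporting the mass
--      of the first lump to the second.)
--  (2) Chamber above the face.  The adjoint chamber X^[S,T] of a face point x has the
--      signs of x off H_(S|T) and Σ_S > 0 on it; by (1) it lies in σ^∨_F iff T is not an
--      initial union and Prefix≥0 F x.
--  (3) Restricted chambers.  Prefixes of F|_S are prefixes of F intersected with S, so
--      by (1) the chamber of x|_S lies in σ^∨_{F|_S} iff Prefix≥0 F (x|_S).
--  (4) If S is an initial union, Prefix≥0 F x iff Prefix≥0 for both x|_S and x|_T;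
--      S and T are never both initial unions.
-- The theorem follows by a case split on which of S, T is an initial union.

open import Defs

open import Data.Bool using (true; false; if_then_else_; _∧_; _∨_; not)
import Data.Bool.Properties as Boolₚ
open import Data.Empty using (⊥-elim)
open import Data.Fin using (Fin; zero; suc; toℕ)
open import Data.Fin.Subset
  using (Subset; ⊤; ⊥; ∁; Nonempty; Empty; _∈_; _∉_; _∩_; _∪_; ⋃; ⁅_⁆; _⊆_)
open import Data.Fin.Subset.Properties
  using (x∈p∪q⁻; x∈p∪q⁺; x∈p∩q⁺; x∈p∩q⁻; ∉⊥; ∈⊤; x∈∁p⇒x∉p; x∈⁅y⁆⇒x≡y; nonempty?)
open import Data.List as List using (List; []; _∷_; foldr; allFin; tabulate; take; length; filter; map)
import Data.List.Properties as Listₚ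
open import Data.List.Membership.Propositional.Properties using (∈-lookup)
open import Data.List.Relation.Unary.All as All using (All; []; _∷_)
import Data.List.Relation.Unary.All.Properties as Allₚ
open import Data.List.Relation.Unary.AllPairs as AllPairs using (AllPairs; []; _∷_)
import Data.List.Relation.Unary.AllPairs.Properties as AllPairsₚ
open import Data.Nat as ℕ using (ℕ; zero; suc; z≤n; s≤s)
import Data.Nat.Properties as ℕₚ
open import Data.Product using (Σ; _×_; _,_; proj₁; proj₂)
open import Data.Product.Function.NonDependent.Propositional using (_×-⇔_)
open import Data.Sum using (_⊎_; inj₁; inj₂; [_,_]′)
open import Data.Vec using ([]; _∷_; lookup)
import Data.Vec.Properties as Vecₚ
open import Function using (_∘_; _⇔_; mk⇔; Equivalence)
open import Function.Construct.Composition using (_⇔-∘_)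
open import Function.Construct.Symmetry using (⇔-sym)
open import Level using (0ℓ)
open import Relation.Binary.Definitions using (tri<; tri≈; tri>)
open import Relation.Binary.PropositionalEquality
open import Relation.Nullary using (¬_; Dec; yes; no)
open import Relation.Unary using (Pred; Decidable)

module Lemmas where
  open import Data.Integer as ℤ using (ℤ)
  open import Data.Rational
    using (ℚ; 0ℚ; _+_; _-_; _*_; -_; _≤_; _<_; 1/_; NonZero; positive; nonNegative)
  open import Data.Rational.Properties

  private
    variable
      n : ℕ

  -- Finite sums of rational vectors.  The sums in Defs are all of this form:
  -- sumOver U h is definitionally total (restrictV U h).

  sumL : List (Fin n) → Vect n → ℚ
  sumL l f = foldr (λ i acc → f i + acc) 0ℚ l

  total : Vect n → ℚ
  total f = sumL (allFin _) f

  module _ {n : ℕ} where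
    open import Data.Rational.Solver
    open +-*-Solver

    sumL-cong : ∀ (l : List (Fin n)) {f g : Vect n} → (∀ i → f i ≡ g i) → sumL l f ≡ sumL l g
    sumL-cong []      e = refl
    sumL-cong (x ∷ l) e = cong₂ _+_ (e x) (sumL-cong l e)

    sumL-+ : ∀ (l : List (Fin n)) (f g : Vect n) → sumL l (λ i → f i + g i) ≡ sumL l f + sumL l g
    sumL-+ []      f g = refl
    sumL-+ (x ∷ l) f g rewrite sumL-+ l f g =
      solve 4 (λ a b c d → (a :+ b) :+ (c :+ d) := (a :+ c) :+ (b :+ d)) refl (f x) (g x) (sumL l f) (sumL l g)

    sumL-neg : ∀ (l : List (Fin n)) (f : Vect n) → sumL l (λ i → - f i) ≡ - sumL l f
    sumL-neg []      f = refl
    sumL-neg (x ∷ l) f rewrite sumL-neg l f = sym (neg-distrib-+ (f x) (sumL l f))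

    sumL-- : ∀ (l : List (Fin n)) (f g : Vect n) → sumL l (λ i → f i - g i) ≡ sumL l f - sumL l g
    sumL-- l f g = trans (sumL-+ l f (λ i → - g i)) (cong (sumL l f +_) (sumL-neg l g))

    sumL-0 : ∀ (l : List (Fin n)) → sumL l (λ _ → 0ℚ) ≡ 0ℚ
    sumL-0 []      = refl
    sumL-0 (x ∷ l) rewrite sumL-0 l = refl

    sumL-*ˡ : ∀ (l : List (Fin n)) k (f : Vect n) → sumL l (λ i → k * f i) ≡ k * sumL l f
    sumL-*ˡ []      k f = sym (*-zeroʳ k)
    sumL-*ˡ (x ∷ l) k f rewrite sumL-*ˡ l k f = sym (*-distribˡ-+ k (f x) (sumL l f))

    sumL-≥0 : ∀ (l : List (Fin n)) (f : Vect n) → (∀ i → 0ℚ ≤ f i) → 0ℚ ≤ sumL l f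
    sumL-≥0 []      f f≥0 = ≤-refl
    sumL-≥0 (x ∷ l) f f≥0 = +-mono-≤ (f≥0 x) (sumL-≥0 l f f≥0)

    sumL-swap : ∀ (l l' : List (Fin n)) (f : Fin n → Fin n → ℚ) →
      sumL l (λ i → sumL l' (f i)) ≡ sumL l' (λ j → sumL l (λ i → f i j))
    sumL-swap []      l' f = sym (sumL-0 l')
    sumL-swap (x ∷ l) l' f rewrite sumL-swap l l' f = sym (sumL-+ l' (f x) (λ j → sumL l (λ i → f i j)))

  sumL-tabulate : ∀ {m n} (g : Fin m → Fin n) (f : Vect n) →
    sumL (tabulate g) f ≡ total (f ∘ g)
  sumL-tabulate {zero}  g f = refl
  sumL-tabulate {suc m} g f =
    cong (f (g zero) +_) (trans (sumL-tabulate (g ∘ suc) f) (sym (sumL-tabulate suc (f ∘ g))))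

  total-suc : (f : Vect (suc n)) → total f ≡ f zero + total (f ∘ suc)
  total-suc f = cong (f zero +_) (sumL-tabulate suc f)

  total-nonneg-zero : (f : Vect n) → (∀ i → 0ℚ ≤ f i) → total f ≡ 0ℚ → ∀ i → f i ≡ 0ℚ
  total-nonneg-zero {suc n} f f≥0 f0 = pointwise
    where
    rest≥0 : 0ℚ ≤ total (f ∘ suc)
    rest≥0 = sumL-≥0 (allFin n) (f ∘ suc) (f≥0 ∘ suc)
    head+rest : f zero + total (f ∘ suc) ≡ 0ℚ
    head+rest = trans (sym (total-suc f)) f0
    head≡0 : f zero ≡ 0ℚ
    head≡0 = ≤-antisym
      (≤-trans (≤-reflexive (sym (+-identityʳ (f zero))))
        (≤-trans (+-monoʳ-≤ (f zero) rest≥0) (≤-reflexive head+rest)))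
      (f≥0 zero)
    rest≡0 : total (f ∘ suc) ≡ 0ℚ
    rest≡0 = trans (sym (+-identityˡ _)) (trans (cong (_+ total (f ∘ suc)) (sym head≡0)) head+rest)
    pointwise : ∀ i → f i ≡ 0ℚ
    pointwise zero    = head≡0
    pointwise (suc i) = total-nonneg-zero (f ∘ suc) (f≥0 ∘ suc) rest≡0 i

  module _ {n : ℕ} where
    lookup-∩ : ∀ (U V : Subset n) i → lookup (U ∩ V) i ≡ lookup U i ∧ lookup V i
    lookup-∩ U V i = Vecₚ.lookup-zipWith _∧_ i U V

    lookup-∪ : ∀ (U V : Subset n) i → lookup (U ∪ V) i ≡ lookup U i ∨ lookup V i
    lookup-∪ U V i = Vecₚ.lookup-zipWith _∨_ i U V

    lookup-∁ : ∀ (U : Subset n) i → lookup (∁ U) i ≡ not (lookup U i)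
    lookup-∁ U i = Vecₚ.lookup-map i not U

    lookup-⊤ : ∀ (i : Fin n) → lookup (⊤ {n}) i ≡ true
    lookup-⊤ i = Vecₚ.lookup-replicate i true

    lookup-⊥ : ∀ (i : Fin n) → lookup (⊥ {n}) i ≡ false
    lookup-⊥ i = Vecₚ.lookup-replicate i false

    ∈⇒true : ∀ {U : Subset n} {i} → i ∈ U → lookup U i ≡ true
    ∈⇒true = Vecₚ.[]=⇒lookup

    true⇒∈ : ∀ {U : Subset n} {i} → lookup U i ≡ true → i ∈ U
    true⇒∈ {U} {i} = Vecₚ.lookup⇒[]= i U

    false⇒∉ : ∀ {U : Subset n} {i} → lookup U i ≡ false → i ∉ U
    false⇒∉ e i∈U with trans (sym (∈⇒true i∈U)) e
    ... | ()

    ∉⇒false : ∀ {U : Subset n} {i} → i ∉ U → lookup U i ≡ false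
    ∉⇒false {U} {i} i∉U with lookup U i in eq
    ... | true  = ⊥-elim (i∉U (true⇒∈ eq))
    ... | false = refl

  ∁-involutive : (S : Subset n) → ∁ (∁ S) ≡ S
  ∁-involutive []      = refl
  ∁-involutive (b ∷ S) = cong₂ _∷_ (Boolₚ.not-involutive b) (∁-involutive S)

  Empty-⊥ : Empty (⊥ {n})
  Empty-⊥ (i , i∈⊥) = ∉⊥ i∈⊥

  module _ {n : ℕ} where
    open import Data.Rational.Solver
    open +-*-Solver

    sumOver-⊤ : ∀ (h : Vect n) → sumOver ⊤ h ≡ total h
    sumOver-⊤ h = sumL-cong (allFin n) (λ i → cong (λ b → if b then h i else 0ℚ) (lookup-⊤ i))

    sumOver-support : ∀ (A : Subset n) (h : Vect n) → (∀ i → i ∉ A → h i ≡ 0ℚ) → sumOver A h ≡ total h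
    sumOver-support A h supp = sumL-cong (allFin n) pointwise
      where
      pointwise : ∀ i → restrictV A h i ≡ h i
      pointwise i with lookup A i in eq
      ... | true  = refl
      ... | false = sym (supp i (false⇒∉ eq))

    sumOver-empty : ∀ (U : Subset n) (h : Vect n) → Empty U → sumOver U h ≡ 0ℚ
    sumOver-empty U h empty = trans (sumL-cong (allFin n) pointwise) (sumL-0 (allFin n))
      where
      pointwise : ∀ i → restrictV U h i ≡ 0ℚ
      pointwise i with lookup U i in eq
      ... | true  = ⊥-elim (empty (i , true⇒∈ eq))
      ... | false = refl

    sumOver-∪ : ∀ (U V : Subset n) (h : Vect n) → Empty (U ∩ V) → sumOver (U ∪ V) h ≡ sumOver U h + sumOver V h
    sumOver-∪ U V h disjoint = trans (sumL-cong (allFin n) pointwise) (sumL-+ (allFin n) (restrictV U h) (restrictV V h))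
      where
      pointwise : ∀ i → restrictV (U ∪ V) h i ≡ restrictV U h i + restrictV V h i
      pointwise i rewrite lookup-∪ U V i with lookup U i in eu | lookup V i in ev
      ... | true  | true  = ⊥-elim (disjoint (i , x∈p∩q⁺ (true⇒∈ eu , true⇒∈ ev)))
      ... | true  | false = sym (+-identityʳ _)
      ... | false | true  = sym (+-identityˡ _)
      ... | false | false = refl

    sumOver-split : ∀ (U S : Subset n) (h : Vect n) →
      sumOver U h ≡ sumOver U (restrictV S h) + sumOver U (restrictV (∁ S) h)
    sumOver-split U S h = trans (sumL-cong (allFin n) pointwise)
                                (sumL-+ (allFin n) (restrictV U (restrictV S h)) (restrictV U (restrictV (∁ S) h)))
      where
      pointwise : ∀ i → restrictV U h i ≡ restrictV U (restrictV S h) i + restrictV U (restrictV (∁ S) h) i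
      pointwise i rewrite lookup-∁ S i with lookup U i | lookup S i
      ... | true  | true  = sym (+-identityʳ (h i))
      ... | true  | false = sym (+-identityˡ (h i))
      ... | false | _     = refl

    sumOver-complement : ∀ (S : Subset n) (h : Vect n) → sumOver S h + sumOver (∁ S) h ≡ total h
    sumOver-complement S h = trans (sym (sumL-+ (allFin n) (restrictV S h) (restrictV (∁ S) h))) (sumL-cong (allFin n) pointwise)
      where
      pointwise : ∀ i → restrictV S h i + restrictV (∁ S) h i ≡ h i
      pointwise i rewrite lookup-∁ S i with lookup S i
      ... | true  = +-identityʳ (h i)
      ... | false = +-identityˡ (h i)

    sumOver-∁ : ∀ (S : Subset n) (h : Vect n) → total h ≡ 0ℚ → sumOver (∁ S) h ≡ - sumOver S h
    sumOver-∁ S h h0 = begin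
      sumOver (∁ S) h
        ≡⟨ solve 2 (λ a b → b := (:- a) :+ (a :+ b)) refl (sumOver S h) (sumOver (∁ S) h) ⟩
      - sumOver S h + (sumOver S h + sumOver (∁ S) h)  ≡⟨ cong (- sumOver S h +_) (trans (sumOver-complement S h) h0) ⟩
      - sumOver S h + 0ℚ                               ≡⟨ +-identityʳ _ ⟩
      - sumOver S h                                    ∎
      where open ≡-Reasoning

    sumOver-restrict : ∀ (V U S : Subset n) → (∀ i → lookup V i ≡ lookup U i ∧ lookup S i) →
      (h : Vect n) → sumOver V h ≡ sumOver U (restrictV S h)
    sumOver-restrict V U S V≡U∩S h = sumL-cong (allFin n) pointwise
      where
      pointwise : ∀ i → restrictV V h i ≡ restrictV U (restrictV S h) i
      pointwise i rewrite V≡U∩S i with lookup U i | lookup S i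
      ... | true  | true  = refl
      ... | true  | false = refl
      ... | false | _     = refl

    sumOver-restrict-⊆ : ∀ (U S : Subset n) (h : Vect n) → U ⊆ S → sumOver U (restrictV S h) ≡ sumOver U h
    sumOver-restrict-⊆ U S h U⊆S = sumL-cong (allFin n) pointwise
      where
      pointwise : ∀ i → restrictV U (restrictV S h) i ≡ restrictV U h i
      pointwise i with lookup U i in eu | lookup S i in es
      ... | true  | true  = refl
      ... | true  | false = ⊥-elim (false⇒∉ es (U⊆S (true⇒∈ eu)))
      ... | false | _     = refl

    sumOver-restrict-⊇ : ∀ (U V : Subset n) (h : Vect n) → V ⊆ U → sumOver U (restrictV V h) ≡ sumOver V h
    sumOver-restrict-⊇ U V h V⊆U = sumL-cong (allFin n) pointwise
      where
      pointwise : ∀ i → restrictV U (restrictV V h) i ≡ restrictV V h i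
      pointwise i with lookup U i in eu | lookup V i in ev
      ... | true  | _     = refl
      ... | false | true  = ⊥-elim (false⇒∉ eu (V⊆U (true⇒∈ ev)))
      ... | false | false = refl

    sumOver-restrict-∁ : ∀ (U V : Subset n) (h : Vect n) → U ⊆ V → sumOver U (restrictV (∁ V) h) ≡ 0ℚ
    sumOver-restrict-∁ U V h U⊆V = trans (sumL-cong (allFin n) pointwise) (sumL-0 (allFin n))
      where
      pointwise : ∀ i → restrictV U (restrictV (∁ V) h) i ≡ 0ℚ
      pointwise i rewrite lookup-∁ V i with lookup U i in eu | lookup V i in ev
      ... | true  | true  = refl
      ... | true  | false = ⊥-elim (false⇒∉ ev (U⊆V (true⇒∈ eu)))
      ... | false | _     = refl

  total-single : (r : Fin n) (v : ℚ) → total (restrictV ⁅ r ⁆ (λ _ → v)) ≡ v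
  total-single {suc n} zero    v = trans (total-suc {n} (restrictV ⁅ zero ⁆ (λ _ → v))) (trans (cong (v +_) rest≡0) (+-identityʳ v))
    where
    rest≡0 : total (λ i → if lookup (⊥ {n}) i then v else 0ℚ) ≡ 0ℚ
    rest≡0 = trans (sumL-cong (allFin n) (λ i → cong (λ b → if b then v else 0ℚ) (lookup-⊥ i))) (sumL-0 (allFin n))
  total-single {suc n} (suc r) v = trans (total-suc {n} (restrictV ⁅ suc r ⁆ (λ _ → v))) (trans (+-identityˡ _) (total-single r v))

  Disjoint : Subset n → Subset n → Set
  Disjoint B C = Empty (B ∩ C)

  Prefix : List (Subset n) → ℕ → Subset n
  Prefix F k = ⋃ (take k F)

  module _ {n : ℕ} where
    ∈-Prefix⁻ : ∀ (F : List (Subset n)) k {i} → i ∈ Prefix F k →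
      Σ (Fin (length F)) λ p → toℕ p ℕ.< k × i ∈ List.lookup F p
    ∈-Prefix⁻ []      zero    i∈ = ⊥-elim (∉⊥ i∈)
    ∈-Prefix⁻ []      (suc k) i∈ = ⊥-elim (∉⊥ i∈)
    ∈-Prefix⁻ (B ∷ F) zero    i∈ = ⊥-elim (∉⊥ i∈)
    ∈-Prefix⁻ (B ∷ F) (suc k) i∈ with x∈p∪q⁻ B (Prefix F k) i∈
    ... | inj₁ i∈B = zero , s≤s z≤n , i∈B
    ... | inj₂ i∈rest with ∈-Prefix⁻ F k i∈rest
    ...   | p , p<k , i∈p = suc p , s≤s p<k , i∈p

    ∈-Prefix⁺ : ∀ (F : List (Subset n)) k (p : Fin (length F)) {i} →
      toℕ p ℕ.< k → i ∈ List.lookup F p → i ∈ Prefix F k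
    ∈-Prefix⁺ (B ∷ F) (suc k) zero    p<k       i∈ = x∈p∪q⁺ (inj₁ i∈)
    ∈-Prefix⁺ (B ∷ F) (suc k) (suc p) (s≤s p<k) i∈ = x∈p∪q⁺ (inj₂ (∈-Prefix⁺ F k p p<k i∈))

    Prefix-mono : ∀ (F : List (Subset n)) {k k'} → k ℕ.≤ k' → Prefix F k ⊆ Prefix F k'
    Prefix-mono F {k} {k'} k≤k' i∈ with ∈-Prefix⁻ F k i∈
    ... | p , p<k , i∈p = ∈-Prefix⁺ F k' p (ℕₚ.<-≤-trans p<k k≤k') i∈p

    All-lookup : ∀ {P : Subset n → Set} (F : List (Subset n)) → All P F → (p : Fin (length F)) → P (List.lookup F p)
    All-lookup F all p = All.lookup all (∈-lookup p)

    lump-unique : ∀ (F : List (Subset n)) → AllPairs Disjoint F → (p q : Fin (length F)) {i : Fin n} →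
      i ∈ List.lookup F p → i ∈ List.lookup F q → p ≡ q
    lump-unique (B ∷ F) ap         zero    zero    i∈p i∈q = refl
    lump-unique (B ∷ F) (dB ∷ ap) zero    (suc q) i∈p i∈q = ⊥-elim (All-lookup F dB q (_ , x∈p∩q⁺ (i∈p , i∈q)))
    lump-unique (B ∷ F) (dB ∷ ap) (suc p) zero    i∈p i∈q = ⊥-elim (All-lookup F dB p (_ , x∈p∩q⁺ (i∈q , i∈p)))
    lump-unique (B ∷ F) (dB ∷ ap) (suc p) (suc q) i∈p i∈q = cong suc (lump-unique F ap p q i∈p i∈q)

    disjoint-Prefix : ∀ (B : Subset n) (F : List (Subset n)) k → All (Disjoint B) F → Disjoint B (Prefix F k)
    disjoint-Prefix B F k dB (i , i∈) with x∈p∩q⁻ B (Prefix F k) i∈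
    ... | i∈B , i∈pre with ∈-Prefix⁻ F k i∈pre
    ...   | p , _ , i∈p = All-lookup F dB p (i , x∈p∩q⁺ (i∈B , i∈p))

  Prefix≥0 : List (Subset n) → Vect n → Set
  Prefix≥0 F h = ∀ k → 0ℚ ≤ sumOver (Prefix F k) h

  -- Necessity in the cone criterion: a flow along coroots e_i - e_j, with the lump
  -- of i weakly left of that of j, never removes mass from an initial union, since
  -- each term c_ij leaving the prefix U also starts in U.
  InCone⇒Prefix≥0 : (F : List (Subset n)) → AllPairs Disjoint F → (h : Vect n) → InCone F h → Prefix≥0 F h
  InCone⇒Prefix≥0 {n} F disjoint h (c , c≥0 , c-left , h≡flow) k =
    ≤-trans (sumL-≥0 l _ (λ m → sumL-≥0 l _ (net≥0 m))) (≤-reflexive (sym sum≡net))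
    where
    U : Subset n
    U = Prefix F k
    l : List (Fin n)
    l = allFin n
    out : Fin n → Fin n → ℚ
    out m j = if lookup U m then c m j else 0ℚ
    into : Fin n → Fin n → ℚ
    into m j = if lookup U j then c m j else 0ℚ
    restricted-flow : ∀ m → restrictV U h m ≡ sumL l (out m) - sumL l (λ i → if lookup U m then c i m else 0ℚ)
    restricted-flow m with lookup U m
    ... | true  = h≡flow m
    ... | false = sym (cong₂ _-_ (sumL-0 l) (sumL-0 l))
    sum≡net : sumOver U h ≡ sumL l (λ m → sumL l (λ j → out m j - into m j))
    sum≡net = begin
      sumOver U h
        ≡⟨ sumL-cong l restricted-flow ⟩
      sumL l (λ m → sumL l (out m) - sumL l (λ i → if lookup U m then c i m else 0ℚ))
        ≡⟨ sumL-- l (λ m → sumL l (out m)) (λ m → sumL l (λ i → if lookup U m then c i m else 0ℚ)) ⟩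
      sumL l (λ m → sumL l (out m)) - sumL l (λ m → sumL l (λ i → if lookup U m then c i m else 0ℚ))
        ≡⟨ cong (λ v → sumL l (λ m → sumL l (out m)) - v) (sumL-swap l l (λ m i → if lookup U m then c i m else 0ℚ)) ⟩
      sumL l (λ m → sumL l (out m)) - sumL l (λ m → sumL l (into m))
        ≡⟨ sym (sumL-- l (λ m → sumL l (out m)) (λ m → sumL l (into m))) ⟩
      sumL l (λ m → sumL l (out m) - sumL l (into m))
        ≡⟨ sumL-cong l (λ m → sym (sumL-- l (out m) (into m))) ⟩
      sumL l (λ m → sumL l (λ j → out m j - into m j)) ∎
      where open ≡-Reasoning
    net≥0 : ∀ m j → 0ℚ ≤ out m j - into m j
    net≥0 m j with lookup U m in em | lookup U j in ej
    ... | true  | true  = ≤-reflexive (sym (+-inverseʳ (c m j)))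
    ... | true  | false = ≤-trans (c≥0 m j) (≤-reflexive (sym (+-identityʳ (c m j))))
    ... | false | false = ≤-refl
    ... | false | true with c m j ≟ 0ℚ
    ...   | yes c≡0 = ≤-reflexive (sym (cong (λ v → 0ℚ - v) c≡0))
    ...   | no c≢0 with c-left m j c≢0
    ...     | _ , p , q , p≤q , m∈p , j∈q with ∈-Prefix⁻ F k (true⇒∈ ej)
    ...       | q' , q'<k , j∈q' with lump-unique F disjoint q' q j∈q' j∈q
    ...         | refl = ⊥-elim (false⇒∉ em (∈-Prefix⁺ F k p (ℕₚ.≤-<-trans p≤q q'<k) m∈p))

  module _ {n : ℕ} where
    InCone-zero : ∀ (F : List (Subset n)) (h : Vect n) → (∀ i → h i ≡ 0ℚ) → InCone F h
    InCone-zero F h h≡0 =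
      (λ _ _ → 0ℚ) , (λ _ _ → ≤-refl) , (λ i j c≢0 → ⊥-elim (c≢0 refl)) ,
      λ m → trans (h≡0 m) (sym (cong₂ _-_ (sumL-0 (allFin n)) (sumL-0 (allFin n))))

    InCone-+ : ∀ (F : List (Subset n)) (f g h : Vect n) → InCone F f → InCone F g →
      (∀ i → h i ≡ f i + g i) → InCone F h
    InCone-+ F f g h (c , c≥0 , c-left , f≡) (d , d≥0 , d-left , g≡) h≡f+g =
      (λ i j → c i j + d i j) , (λ i j → +-mono-≤ (c≥0 i j) (d≥0 i j)) , left , flow
      where
      left : ∀ i j → c i j + d i j ≢ 0ℚ → i ≢ j × WeaklyLeft F i j
      left i j ≢0 with c i j ≟ 0ℚ | d i j ≟ 0ℚ
      ... | no c≢0  | _        = c-left i j c≢0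
      ... | yes _   | no d≢0   = d-left i j d≢0
      ... | yes c≡0 | yes d≡0  = ⊥-elim (≢0 (cong₂ _+_ c≡0 d≡0))
      l : List (Fin n)
      l = allFin n
      flow : ∀ m → h m ≡ sumL l (λ j → c m j + d m j) - sumL l (λ i → c i m + d i m)
      flow m rewrite sumL-+ l (c m) (d m) | sumL-+ l (λ i → c i m) (λ i → d i m) | h≡f+g m | f≡ m | g≡ m =
        solve 4 (λ a b x y → (a :- b) :+ (x :- y) := (a :+ x) :- (b :+ y)) refl
          (sumL l (c m)) (sumL l (λ i → c i m)) (sumL l (d m)) (sumL l (λ i → d i m))
        where open import Data.Rational.Solver
              open +-*-Solver

    InCone-∷ : ∀ (B : Subset n) (F : List (Subset n)) (h : Vect n) → InCone F h → InCone (B ∷ F) h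
    InCone-∷ B F h (c , c≥0 , c-left , h≡flow) = c , c≥0 , left , h≡flow
      where
      left : ∀ i j → c i j ≢ 0ℚ → i ≢ j × WeaklyLeft (B ∷ F) i j
      left i j c≢0 with c-left i j c≢0
      ... | i≢j , p , q , p≤q , i∈p , j∈q = i≢j , suc p , suc q , s≤s p≤q , i∈p , j∈q

  pos : ℚ → ℚ
  pos x with 0ℚ ≤? x
  ... | yes _ = x
  ... | no  _ = 0ℚ

  neg : ℚ → ℚ
  neg x with 0ℚ ≤? x
  ... | yes _ = 0ℚ
  ... | no  _ = - x

  ≤∧≢⇒< : ∀ {x} → 0ℚ ≤ x → x ≢ 0ℚ → 0ℚ < x
  ≤∧≢⇒< {x} 0≤x x≢0 with <-cmp 0ℚ x
  ... | tri< 0<x _ _ = 0<x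
  ... | tri≈ _ 0≡x _ = ⊥-elim (x≢0 (sym 0≡x))
  ... | tri> _ _ x<0 = ⊥-elim (<-irrefl refl (≤-<-trans 0≤x x<0))

  pos≥0 : ∀ x → 0ℚ ≤ pos x
  pos≥0 x with 0ℚ ≤? x
  ... | yes 0≤x = 0≤x
  ... | no  _   = ≤-refl

  neg≥0 : ∀ x → 0ℚ ≤ neg x
  neg≥0 x with 0ℚ ≤? x
  ... | yes _   = ≤-refl
  ... | no  0≰x = <⇒≤ (neg-antimono-< (≰⇒> 0≰x))

  pos-neg : ∀ x → pos x - neg x ≡ x
  pos-neg x with 0ℚ ≤? x
  ... | yes _ = +-identityʳ x
  ... | no  _ = solve 1 (λ x → con 0ℚ :- (:- x) := x) refl x
    where open import Data.Rational.Solver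
          open +-*-Solver

  neg≡pos-x : ∀ x → neg x ≡ pos x - x
  neg≡pos-x x with 0ℚ ≤? x
  ... | yes _ = sym (+-inverseʳ x)
  ... | no  _ = sym (+-identityˡ (- x))

  pos≢0⇒> : ∀ x → pos x ≢ 0ℚ → 0ℚ < x
  pos≢0⇒> x pos≢0 with 0ℚ ≤? x
  ... | yes 0≤x = ≤∧≢⇒< 0≤x pos≢0
  ... | no  _   = ⊥-elim (pos≢0 refl)

  neg≢0⇒< : ∀ x → neg x ≢ 0ℚ → x < 0ℚ
  neg≢0⇒< x neg≢0 with 0ℚ ≤? x
  ... | yes _   = ⊥-elim (neg≢0 refl)
  ... | no  0≰x = ≰⇒> 0≰x

  total-neg : (g : Vect n) → total g ≡ 0ℚ → total (neg ∘ g) ≡ total (pos ∘ g)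
  total-neg {n} g g0 = begin
    total (neg ∘ g)                   ≡⟨ sumL-cong (allFin n) (λ i → neg≡pos-x (g i)) ⟩
    total (λ i → pos (g i) - g i)     ≡⟨ sumL-- (allFin n) (pos ∘ g) g ⟩
    total (pos ∘ g) - total g         ≡⟨ cong (λ v → total (pos ∘ g) - v) g0 ⟩
    total (pos ∘ g) - 0ℚ              ≡⟨ +-identityʳ _ ⟩
    total (pos ∘ g)                   ∎
    where open ≡-Reasoning

  no-positive-mass : (g : Vect n) → total g ≡ 0ℚ → total (pos ∘ g) ≡ 0ℚ → ∀ i → g i ≡ 0ℚ
  no-positive-mass g g0 pos0 i = begin
    g i                 ≡⟨ sym (pos-neg (g i)) ⟩
    pos (g i) - neg (g i) ≡⟨ cong₂ _-_ (total-nonneg-zero (pos ∘ g) (pos≥0 ∘ g) pos0 i)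
                                        (total-nonneg-zero (neg ∘ g) (neg≥0 ∘ g) (trans (total-neg g g0) pos0) i) ⟩
    0ℚ - 0ℚ             ≡⟨ +-inverseʳ 0ℚ ⟩
    0ℚ                  ∎
    where open ≡-Reasoning

  -- The proportional transport plan of a zero-sum vector g with positive mass N:
  -- c_ij = g_i⁺ g_j⁻ / N moves mass only from positive to negative coordinates and
  -- has row sums g⁺ and column sums g⁻, hence realises g as a flow.
  module ProportionalPlan {n : ℕ} (g : Vect n) (g0 : total g ≡ 0ℚ) (N>0 : 0ℚ < total (pos ∘ g)) where
    open import Data.Rational.Solver
    open +-*-Solver
    open ≡-Reasoning

    N : ℚ
    N = total (pos ∘ g)
    l : List (Fin n)
    l = allFin n

    instance
      N-nonZero : NonZero N
      N-nonZero = pos⇒nonZero N {{positive N>0}}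

    plan : Fin n → Fin n → ℚ
    plan i j = pos (g i) * neg (g j) * 1/ N

    plan≥0 : ∀ i j → 0ℚ ≤ plan i j
    plan≥0 i j = nonNegative⁻¹ (plan i j)
      {{nonNeg*nonNeg⇒nonNeg (pos (g i) * neg (g j))
        {{nonNeg*nonNeg⇒nonNeg (pos (g i)) {{nonNegative (pos≥0 (g i))}} (neg (g j)) {{nonNegative (neg≥0 (g j))}}}}
        (1/ N) {{nonNegative (<⇒≤ (positive⁻¹ (1/ N) {{1/pos⇒pos N {{positive N>0}}}}))}}}}

    plan-support : ∀ i j → plan i j ≢ 0ℚ → 0ℚ < g i × g j < 0ℚ
    plan-support i j plan≢0 = pos≢0⇒> (g i) pos≢0 , neg≢0⇒< (g j) neg≢0
      where
      pos≢0 : pos (g i) ≢ 0ℚ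
      pos≢0 p≡0 = plan≢0 (trans (cong (λ v → v * neg (g j) * 1/ N) p≡0)
                                (trans (cong (_* 1/ N) (*-zeroˡ (neg (g j)))) (*-zeroˡ (1/ N))))
      neg≢0 : neg (g j) ≢ 0ℚ
      neg≢0 n≡0 = plan≢0 (trans (cong (λ v → pos (g i) * v * 1/ N) n≡0)
                                (trans (cong (_* 1/ N) (*-zeroʳ (pos (g i)))) (*-zeroˡ (1/ N))))

    cancel-N : ∀ a → a * 1/ N * N ≡ a
    cancel-N a = trans (*-assoc a (1/ N) N) (trans (cong (a *_) (*-inverseˡ N)) (*-identityʳ a))

    row-sum : ∀ m → sumL l (plan m) ≡ pos (g m)
    row-sum m = begin
      sumL l (plan m)
        ≡⟨ sumL-cong l (λ j → solve 3 (λ a b e → a :* b :* e := (a :* e) :* b) refl (pos (g m)) (neg (g j)) (1/ N)) ⟩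
      sumL l (λ j → (pos (g m) * 1/ N) * neg (g j)) ≡⟨ sumL-*ˡ l (pos (g m) * 1/ N) (neg ∘ g) ⟩
      pos (g m) * 1/ N * total (neg ∘ g)          ≡⟨ cong (pos (g m) * 1/ N *_) (total-neg g g0) ⟩
      pos (g m) * 1/ N * N                        ≡⟨ cancel-N (pos (g m)) ⟩
      pos (g m)                                   ∎

    column-sum : ∀ m → sumL l (λ i → plan i m) ≡ neg (g m)
    column-sum m = begin
      sumL l (λ i → plan i m)
        ≡⟨ sumL-cong l (λ i → solve 3 (λ a b e → a :* b :* e := (b :* e) :* a) refl (pos (g i)) (neg (g m)) (1/ N)) ⟩
      sumL l (λ i → (neg (g m) * 1/ N) * pos (g i)) ≡⟨ sumL-*ˡ l (neg (g m) * 1/ N) (pos ∘ g) ⟩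
      neg (g m) * 1/ N * N                        ≡⟨ cancel-N (neg (g m)) ⟩
      neg (g m)                                   ∎

    plan-flow : ∀ m → g m ≡ sumL l (plan m) - sumL l (λ i → plan i m)
    plan-flow m = trans (sym (pos-neg (g m))) (sym (cong₂ _-_ (row-sum m) (column-sum m)))

  InCone-transport : (F : List (Subset n)) (g : Vect n) → total g ≡ 0ℚ →
    (∀ i j → 0ℚ < g i → g j < 0ℚ → WeaklyLeft F i j) → InCone F g
  InCone-transport F g g0 left with total (pos ∘ g) ≟ 0ℚ
  ... | yes pos0 = InCone-zero F g (no-positive-mass g g0 pos0)
  ... | no  pos≢0 = plan , plan≥0 , plan-left , plan-flow
    where
    open ProportionalPlan g g0 (≤∧≢⇒< (sumL-≥0 (allFin _) (pos ∘ g) (pos≥0 ∘ g)) pos≢0)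
    plan-left : ∀ i j → plan i j ≢ 0ℚ → i ≢ j × WeaklyLeft F i j
    plan-left i j plan≢0 with plan-support i j plan≢0
    ... | gi>0 , gj<0 = (λ { refl → <-asym gi>0 gj<0 }) , left i j gi>0 gj<0

  -- With P = Σ_B h we
  -- split h = h₁ + h₂, where h₁ = h|_B - P e_r is a zero-sum vector transporting
  -- the mass of B to r, and h₂ agrees with h off B ∪ {r}, vanishes on B and
  -- carries the extra mass P at r.
  module MoveLump {n : ℕ} (B : Subset n) (r : Fin n) (h : Vect n) where
    open import Data.Rational.Solver
    open +-*-Solver

    P : ℚ
    P = sumOver B h

    e : Vect n
    e = restrictV ⁅ r ⁆ (λ _ → P)

    h₁ h₂ : Vect n
    h₁ i = restrictV B h i - e i
    h₂ i = h i - h₁ i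

    h≡h₁+h₂ : ∀ i → h i ≡ h₁ i + h₂ i
    h≡h₁+h₂ i = solve 2 (λ a b → a := b :+ (a :- b)) refl (h i) (h₁ i)

    total-h₁ : total h₁ ≡ 0ℚ
    total-h₁ = trans (sumL-- (allFin n) (restrictV B h) e)
                     (trans (cong (λ v → P - v) (total-single r P)) (+-inverseʳ P))

    e-at-r : ∀ {i} → lookup ⁅ r ⁆ i ≡ true → i ≡ r
    e-at-r er = x∈⁅y⁆⇒x≡y r (true⇒∈ er)

    module _ (P≥0 : 0ℚ ≤ P) where
      h₁>0⇒∈B : ∀ i → 0ℚ < h₁ i → i ∈ B
      h₁>0⇒∈B i h₁>0 with lookup B i in eb
      ... | true  = true⇒∈ eb
      ... | false = ⊥-elim (<-irrefl refl (<-≤-trans h₁>0 (≤-trans (≤-reflexive (+-identityˡ (- e i))) (neg-antimono-≤ e≥0))))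
        where
        e≥0 : 0ℚ ≤ e i
        e≥0 with lookup ⁅ r ⁆ i
        ... | true  = P≥0
        ... | false = ≤-refl

      h₁<0⇒∈B∪r : ∀ j → h₁ j < 0ℚ → j ∈ B ⊎ j ≡ r
      h₁<0⇒∈B∪r j h₁<0 with lookup B j in eb | lookup ⁅ r ⁆ j in er
      ... | true  | _     = inj₁ (true⇒∈ eb)
      ... | false | true  = inj₂ (e-at-r er)
      ... | false | false = ⊥-elim (<-irrefl refl h₁<0)

    h₂-support : (W : Subset n) → r ∈ W → (∀ i → i ∉ B → i ∉ W → h i ≡ 0ℚ) → ∀ i → i ∉ W → h₂ i ≡ 0ℚ
    h₂-support W r∈W h-support i i∉W with lookup ⁅ r ⁆ i in er
    ... | true  = ⊥-elim (i∉W (subst (_∈ W) (sym (e-at-r er)) r∈W))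
    ... | false with lookup B i in eb
    ...   | true  = solve 1 (λ a → a :- (a :- con 0ℚ) := con 0ℚ) refl (h i)
    ...   | false rewrite h-support i (false⇒∉ eb) i∉W = refl

    sumOver-h₂ : (U : Subset n) → Disjoint B U → r ∈ U → sumOver U h₂ ≡ P + sumOver U h
    sumOver-h₂ U B∩U r∈U = trans (sumL-cong (allFin n) pointwise)
      (trans (sumL-+ (allFin n) (restrictV U h) e) (trans (cong (sumOver U h +_) (total-single r P)) (+-comm _ P)))
      where
      pointwise : ∀ i → restrictV U h₂ i ≡ restrictV U h i + e i
      pointwise i with lookup U i in eu | lookup B i in eb | lookup ⁅ r ⁆ i in er
      ... | true  | true  | _     = ⊥-elim (B∩U (i , x∈p∩q⁺ (true⇒∈ eb , true⇒∈ eu)))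
      ... | true  | false | true  = solve 2 (λ a p → a :- (con 0ℚ :- p) := a :+ p) refl (h i) P
      ... | true  | false | false = solve 1 (λ a → a :- (con 0ℚ :- con 0ℚ) := a :+ con 0ℚ) refl (h i)
      ... | false | _     | true  = ⊥-elim (false⇒∉ eu (subst (_∈ U) (sym (e-at-r er)) r∈U))
      ... | false | _     | false = refl

  -- By induction on the lumps: the
  -- mass of the first lump is moved to the second one (MoveLump), which is a flow
  -- from left to right, and the remainder is handled by the tail of F.
  Prefix≥0⇒InCone : (F : List (Subset n)) → All Nonempty F → AllPairs Disjoint F → (h : Vect n) →
    (∀ i → i ∉ ⋃ F → h i ≡ 0ℚ) → total h ≡ 0ℚ → Prefix≥0 F h → InCone F h
  Prefix≥0⇒InCone [] _ _ h support _ _ = InCone-zero [] h (λ i → support i ∉⊥)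
  Prefix≥0⇒InCone (B ∷ []) _ _ h support h0 _ =
    InCone-transport (B ∷ []) h h0 λ i j h>0 h<0 →
      zero , zero , z≤n , ∈B i (λ h≡0 → <-irrefl (sym h≡0) h>0) , ∈B j (λ h≡0 → <-irrefl h≡0 h<0)
    where
    ∈B : ∀ i → h i ≢ 0ℚ → i ∈ B
    ∈B i h≢0 with lookup B i in eb
    ... | true  = true⇒∈ eb
    ... | false = ⊥-elim (h≢0 (support i λ i∈ → [ false⇒∉ eb , ∉⊥ ]′ (x∈p∪q⁻ B ⊥ i∈)))
  Prefix≥0⇒InCone {n} (B ∷ B' ∷ F) (_ ∷ nonempty@((r , r∈B') ∷ _)) (dB ∷ disjoint) h support h0 prefix≥0 =
    InCone-+ (B ∷ B' ∷ F) h₁ h₂ h cone₁ (InCone-∷ B (B' ∷ F) h₂ cone₂) h≡h₁+h₂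
    where
    open MoveLump B r h
    P≥0 : 0ℚ ≤ P
    P≥0 = ≤-trans (prefix≥0 1) (≤-reflexive (trans (sumOver-∪ B ⊥ h (λ (i , i∈) → ∉⊥ (proj₂ (x∈p∩q⁻ B ⊥ i∈))))
                                                    (trans (cong (P +_) (sumOver-empty ⊥ h Empty-⊥)) (+-identityʳ P))))
    cone₁ : InCone (B ∷ B' ∷ F) h₁
    cone₁ = InCone-transport (B ∷ B' ∷ F) h₁ total-h₁ λ i j h₁>0 h₁<0 →
      let i∈B = h₁>0⇒∈B P≥0 i h₁>0 in
      [ (λ j∈B → zero , zero , z≤n , i∈B , j∈B)
      , (λ { refl → zero , suc zero , z≤n , i∈B , r∈B' }) ]′ (h₁<0⇒∈B∪r P≥0 j h₁<0)
    tail-support : ∀ i → i ∉ B → i ∉ ⋃ (B' ∷ F) → h i ≡ 0ℚ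
    tail-support i i∉B i∉tail = support i λ i∈ → [ i∉B , i∉tail ]′ (x∈p∪q⁻ B (⋃ (B' ∷ F)) i∈)
    tail-prefix≥0 : Prefix≥0 (B' ∷ F) h₂
    tail-prefix≥0 zero    = ≤-reflexive (sym (sumOver-empty ⊥ h₂ Empty-⊥))
    tail-prefix≥0 (suc k) = ≤-trans (prefix≥0 (suc (suc k)))
      (≤-reflexive (trans (sumOver-∪ B U h B∩U) (sym (sumOver-h₂ U B∩U (x∈p∪q⁺ (inj₁ r∈B'))))))
      where
      U : Subset n
      U = Prefix (B' ∷ F) (suc k)
      B∩U : Disjoint B U
      B∩U = disjoint-Prefix B (B' ∷ F) (suc k) dB
    cone₂ : InCone (B' ∷ F) h₂
    cone₂ = Prefix≥0⇒InCone (B' ∷ F) nonempty disjoint h₂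
      (h₂-support (⋃ (B' ∷ F)) (x∈p∪q⁺ (inj₁ r∈B')) tail-support)
      (trans (sumL-- (allFin n) h h₁) (trans (cong₂ _-_ h0 total-h₁) (+-inverseʳ 0ℚ)))
      tail-prefix≥0

  SameSign-refl : ∀ a → SameSign a a
  SameSign-refl a with <-cmp 0ℚ a
  ... | tri< 0<a _ _ = inj₁ (0<a , 0<a)
  ... | tri≈ _ 0≡a _ = inj₂ (inj₂ (sym 0≡a , sym 0≡a))
  ... | tri> _ _ a<0 = inj₂ (inj₁ (a<0 , a<0))

  SameSign-≥0 : ∀ {a b} → 0ℚ ≤ a → SameSign a b → 0ℚ ≤ b
  SameSign-≥0 _   (inj₁ (_ , 0<b))          = <⇒≤ 0<b
  SameSign-≥0 0≤a (inj₂ (inj₁ (a<0 , _)))   = ⊥-elim (<-irrefl refl (≤-<-trans 0≤a a<0))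
  SameSign-≥0 _   (inj₂ (inj₂ (_ , b≡0)))   = ≤-reflexive (sym b≡0)

  SameSign-≥0⁻ : ∀ {a b} → 0ℚ ≤ b → SameSign a b → 0ℚ ≤ a
  SameSign-≥0⁻ _   (inj₁ (0<a , _))         = <⇒≤ 0<a
  SameSign-≥0⁻ 0≤b (inj₂ (inj₁ (_ , b<0)))  = ⊥-elim (<-irrefl refl (≤-<-trans 0≤b b<0))
  SameSign-≥0⁻ _   (inj₂ (inj₂ (a≡0 , _)))  = ≤-reflexive (sym a≡0)

  SameSign->0 : ∀ {a b} → 0ℚ < a → SameSign a b → 0ℚ < b
  SameSign->0 _   (inj₁ (_ , 0<b))          = 0<b
  SameSign->0 0<a (inj₂ (inj₁ (a<0 , _)))   = ⊥-elim (<-asym 0<a a<0)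
  SameSign->0 0<a (inj₂ (inj₂ (a≡0 , _)))   = ⊥-elim (<-irrefl (sym a≡0) 0<a)

  SameChamber-refl : (A : Subset n) (h : Vect n) → Generic A h → SameChamber A h h
  SameChamber-refl A h generic = generic , generic , λ U _ → SameSign-refl _

  data Shape {n : ℕ} (S U : Subset n) : Set where
    empty  : Empty U → Shape S U
    whole  : U ≡ ⊤ → Shape S U
    left   : U ≡ S → Shape S U
    right  : U ≡ ∁ S → Shape S U
    other  : ProperSub ⊤ U → U ≢ S → U ≢ ∁ S → Shape S U

  _≟ₛ_ : (U V : Subset n) → Dec (U ≡ V)
  _≟ₛ_ = Vecₚ.≡-dec Boolₚ._≟_

  shape : (S U : Subset n) → Shape S U
  shape S U with nonempty? U | U ≟ₛ ⊤ | U ≟ₛ S | U ≟ₛ ∁ S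
  ... | no ¬ne | _       | _      | _      = empty ¬ne
  ... | yes _  | yes U≡⊤ | _      | _      = whole U≡⊤
  ... | yes _  | no _    | yes U≡S | _     = left U≡S
  ... | yes _  | no _    | no _   | yes U≡T = right U≡T
  ... | yes ne | no U≢⊤  | no U≢S | no U≢T = other ((λ _ → ∈⊤) , ne , U≢⊤) U≢S U≢T

  nonneg-by-shape : (S U : Subset n) (v : Vect n) → sumOver ⊤ v ≡ 0ℚ → 0ℚ ≤ sumOver S v → U ≢ ∁ S →
    (ProperSub ⊤ U → U ≢ S → U ≢ ∁ S → 0ℚ ≤ sumOver U v) → 0ℚ ≤ sumOver U v
  nonneg-by-shape S U v v0 vS U≢T bound with shape S U
  ... | empty ¬ne       = ≤-reflexive (sym (sumOver-empty U v ¬ne))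
  ... | whole refl      = ≤-reflexive (sym v0)
  ... | left refl       = vS
  ... | right U≡T       = ⊥-elim (U≢T U≡T)
  ... | other p U≢S U≢T = bound p U≢S U≢T

  -- InitialSeg F T holds iff some prefix union of F equals T (prefixes beyond the
  -- length of F are all of ⋃ F).
  Prefix≡⇒InitialSeg : (F : List (Subset n)) (T : Subset n) → ∀ k → Prefix F k ≡ T → InitialSeg F T
  Prefix≡⇒InitialSeg F T k Fk≡T with k ℕ.≤? length F
  ... | yes k≤len = k , k≤len , Fk≡T
  ... | no  k≰len = length F , ℕₚ.≤-refl ,
    trans (cong ⋃ (Listₚ.take-all (length F) F ℕₚ.≤-refl))
          (trans (cong ⋃ (sym (Listₚ.take-all k F (ℕₚ.≰⇒≥ k≰len)))) Fk≡T)

  -- Off H_(S|∁S) the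
  -- chamber has the signs of x, while on it the sign is forced positive; a prefix
  -- equal to ∁S would have negative sum.
  chamberAbove-InCone : (F : List (Subset n)) → IsComposition ⊤ F →
    (S : Subset n) → Nonempty S → Nonempty (∁ S) →
    (x : Vect n) → FacePoint ⊤ S x → (h : Vect n) → ChamberAbove ⊤ S x h →
    ChamberInCone ⊤ F h ⇔ (¬ InitialSeg F (∁ S) × Prefix≥0 F x)
  chamberAbove-InCone F (nonempty , disjoint , ⋃F≡⊤) S neS (j , j∉S) x ((_ , x⊤) , xS , x-off) h (h-generic , hS>0 , h-signs) =
    mk⇔ to from
    where
    S-proper : ProperSub ⊤ S
    S-proper = (λ _ → ∈⊤) , neS , λ { refl → x∈∁p⇒x∉p j∉S ∈⊤ }
    hT<0 : sumOver (∁ S) h < 0ℚ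
    hT<0 = subst (_< 0ℚ) (sym (sumOver-∁ S h (trans (sym (sumOver-⊤ h)) (proj₂ (proj₁ h-generic)))))
                 (neg-antimono-< hS>0)
    to : ChamberInCone ⊤ F h → ¬ InitialSeg F (∁ S) × Prefix≥0 F x
    to h∈cone = T-not-initial , x-prefix≥0
      where
      h-prefix≥0 : Prefix≥0 F h
      h-prefix≥0 = InCone⇒Prefix≥0 F disjoint h (h∈cone h (SameChamber-refl ⊤ h h-generic))
      T-not-initial : ¬ InitialSeg F (∁ S)
      T-not-initial (k , _ , Fk≡T) = <-irrefl refl (<-≤-trans hT<0 (subst (λ V → 0ℚ ≤ sumOver V h) Fk≡T (h-prefix≥0 k)))
      x-prefix≥0 : Prefix≥0 F x
      x-prefix≥0 k = nonneg-by-shape S (Prefix F k) x x⊤ (≤-reflexive (sym xS))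
        (λ Fk≡T → T-not-initial (Prefix≡⇒InitialSeg F (∁ S) k Fk≡T))
        (λ p U≢S U≢T → SameSign-≥0⁻ (h-prefix≥0 k) (h-signs _ p U≢S U≢T))
    from : ¬ InitialSeg F (∁ S) × Prefix≥0 F x → ChamberInCone ⊤ F h
    from (T-not-initial , x-prefix≥0) h' (_ , h'-generic@((_ , h'⊤) , _) , same) =
      Prefix≥0⇒InCone F nonempty disjoint h' (λ i i∉ → ⊥-elim (i∉ (subst (i ∈_) (sym ⋃F≡⊤) ∈⊤)))
        (trans (sym (sumOver-⊤ h')) h'⊤) h'-prefix≥0
      where
      h'-prefix≥0 : Prefix≥0 F h'
      h'-prefix≥0 k = nonneg-by-shape S (Prefix F k) h' h'⊤ (<⇒≤ (SameSign->0 hS>0 (same S S-proper)))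
        (λ Fk≡T → T-not-initial (Prefix≡⇒InitialSeg F (∁ S) k Fk≡T))
        (λ p U≢S U≢T → <⇒≤ (SameSign->0
          (SameSign->0 (≤∧≢⇒< (x-prefix≥0 k) (x-off _ p U≢S U≢T)) (h-signs _ p U≢S U≢T)) (same _ p)))

  -- Restricting a composition F to S: prefixes of F|_S are the prefixes of F
  -- intersected with S, up to reindexing (empty lumps are dropped).

  module _ {A : Set} {P : Pred A 0ℓ} (P? : Decidable P) where
    take-filter : (L : List A) (k' : ℕ) → Σ ℕ λ k → take k' (filter P? L) ≡ filter P? (take k L)
    take-filter []      k' = 0 , Listₚ.take-[] k'
    take-filter (x ∷ L) k' = step (P? x) k'
      where
      step : Dec (P x) → ∀ k' → Σ ℕ λ k → take k' (filter P? (x ∷ L)) ≡ filter P? (take k (x ∷ L))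
      step (no ¬px) k'       = let (k , e) = take-filter L k' in suc k ,
        trans (cong (take k') (Listₚ.filter-reject P? ¬px)) (trans e (sym (Listₚ.filter-reject P? ¬px)))
      step (yes px) zero     = 0 , refl
      step (yes px) (suc k') = let (k , e) = take-filter L k' in suc k ,
        trans (cong (take (suc k')) (Listₚ.filter-accept P? px)) (trans (cong (x ∷_) e) (sym (Listₚ.filter-accept P? px)))

    filter-take : (L : List A) (k : ℕ) → Σ ℕ λ k' → filter P? (take k L) ≡ take k' (filter P? L)
    filter-take L       zero    = 0 , refl
    filter-take []      (suc k) = 0 , refl
    filter-take (x ∷ L) (suc k) = step (P? x)
      where
      step : Dec (P x) → Σ ℕ λ k' → filter P? (x ∷ take k L) ≡ take k' (filter P? (x ∷ L))
      step (yes px) = let (k' , e) = filter-take L k in suc k' ,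
        trans (Listₚ.filter-accept P? px) (trans (cong (x ∷_) e) (cong (take (suc k')) (sym (Listₚ.filter-accept P? px))))
      step (no ¬px) = let (k' , e) = filter-take L k in k' ,
        trans (Listₚ.filter-reject P? ¬px) (trans e (cong (take k') (sym (Listₚ.filter-reject P? ¬px))))

  _≐_∩_ : Subset n → Subset n → Subset n → Set
  V ≐ U ∩ S = ∀ i → lookup V i ≡ lookup U i ∧ lookup S i

  module _ {n : ℕ} where
    ⋃-filter-nonempty : (L : List (Subset n)) → ∀ i → lookup (⋃ (filter nonempty? L)) i ≡ lookup (⋃ L) i
    ⋃-filter-nonempty []      i = refl
    ⋃-filter-nonempty (B ∷ L) i with nonempty? B
    ... | yes _ rewrite lookup-∪ B (⋃ (filter nonempty? L)) i | lookup-∪ B (⋃ L) i | ⋃-filter-nonempty L i = refl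
    ... | no ¬ne with lookup B i in eb
    ...   | true  = ⊥-elim (¬ne (i , true⇒∈ eb))
    ...   | false rewrite lookup-∪ B (⋃ L) i | eb = ⋃-filter-nonempty L i

    ⋃-map-∩ : (S : Subset n) (L : List (Subset n)) → ⋃ (map (_∩ S) L) ≐ ⋃ L ∩ S
    ⋃-map-∩ S []      i rewrite lookup-⊥ i = refl
    ⋃-map-∩ S (B ∷ L) i
      rewrite lookup-∪ (B ∩ S) (⋃ (map (_∩ S) L)) i | lookup-∪ B (⋃ L) i | lookup-∩ B S i | ⋃-map-∩ S L i
      with lookup B i | lookup (⋃ L) i | lookup S i
    ... | true  | _     | true  = refl
    ... | true  | true  | false = refl
    ... | true  | false | false = refl
    ... | false | _     | _     = refl

    ⋃-restrictC : (S : Subset n) (L : List (Subset n)) → ⋃ (restrictC S L) ≐ ⋃ L ∩ S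
    ⋃-restrictC S L i = trans (⋃-filter-nonempty (map (_∩ S) L) i) (⋃-map-∩ S L i)

    ⋃-filter-take : (S : Subset n) (F : List (Subset n)) (k : ℕ) →
      ⋃ (filter nonempty? (take k (map (_∩ S) F))) ≐ Prefix F k ∩ S
    ⋃-filter-take S F k i = trans (⋃-filter-nonempty (take k (map (_∩ S) F)) i)
      (trans (cong (λ M → lookup (⋃ M) i) (Listₚ.take-map k F)) (⋃-map-∩ S (take k F) i))

    Prefix-restrictC⁻ : (S : Subset n) (F : List (Subset n)) (k' : ℕ) →
      Σ ℕ λ k → Prefix (restrictC S F) k' ≐ Prefix F k ∩ S
    Prefix-restrictC⁻ S F k' = let (k , e) = take-filter nonempty? (map (_∩ S) F) k' in
      k , λ i → trans (cong (λ M → lookup (⋃ M) i) e) (⋃-filter-take S F k i)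

    Prefix-restrictC⁺ : (S : Subset n) (F : List (Subset n)) (k : ℕ) →
      Σ ℕ λ k' → Prefix (restrictC S F) k' ≐ Prefix F k ∩ S
    Prefix-restrictC⁺ S F k = let (k' , e) = filter-take nonempty? (map (_∩ S) F) k in
      k' , λ i → trans (cong (λ M → lookup (⋃ M) i) (sym e)) (⋃-filter-take S F k i)

    sumOver-∩-restrict : (V U S : Subset n) → V ≐ U ∩ S → (x : Vect n) → sumOver V (restrictV S x) ≡ sumOver U (restrictV S x)
    sumOver-∩-restrict V U S V≐U∩S x = trans (sumOver-restrict V U S V≐U∩S (restrictV S x)) (sumL-cong (allFin n) idem)
      where
      idem : ∀ i → restrictV U (restrictV S (restrictV S x)) i ≡ restrictV U (restrictV S x) i
      idem i with lookup U i | lookup S i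
      ... | true  | true  = refl
      ... | true  | false = refl
      ... | false | _     = refl

    sumOver-≐ : (V W : Subset n) → (∀ i → lookup V i ≡ lookup W i) → (h : Vect n) → sumOver V h ≡ sumOver W h
    sumOver-≐ V W V≐W h = sumL-cong (allFin n) (λ i → cong (λ b → if b then h i else 0ℚ) (V≐W i))

  restrictC-composition : (S : Subset n) (F : List (Subset n)) → IsComposition ⊤ F →
    All Nonempty (restrictC S F) × AllPairs Disjoint (restrictC S F) × (∀ i → lookup (⋃ (restrictC S F)) i ≡ lookup S i)
  restrictC-composition S F (_ , disjoint , ⋃F≡⊤) =
    Allₚ.all-filter nonempty? (map (_∩ S) F) ,
    AllPairsₚ.filter⁺ nonempty? (AllPairsₚ.map⁺ (AllPairs.map restrict-disjoint disjoint)) ,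
    λ i → trans (⋃-restrictC S F i) (cong (λ b → b ∧ lookup S i) (trans (cong (λ U → lookup U i) ⋃F≡⊤) (lookup-⊤ i)))
    where
    restrict-disjoint : ∀ {B C} → Disjoint B C → Disjoint (B ∩ S) (C ∩ S)
    restrict-disjoint B∩C (i , i∈) with x∈p∩q⁻ (_ ∩ S) (_ ∩ S) i∈
    ... | i∈B∩S , i∈C∩S = B∩C (i , x∈p∩q⁺ (proj₁ (x∈p∩q⁻ _ S i∈B∩S) , proj₁ (x∈p∩q⁻ _ S i∈C∩S)))

  -- The restriction of a face point x of H_(S|∁S) to S is generic in T^∨_S: a special
  -- hyperplane of S is a special hyperplane of I other than H_(S|∁S).
  restrictV-generic : (S : Subset n) → Nonempty (∁ S) → (x : Vect n) → FacePoint ⊤ S x → Generic S (restrictV S x)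
  restrictV-generic S (j , j∉S) x (_ , xS , x-off) =
    ((λ i i∉S → cong (λ b → if b then x i else 0ℚ) (∉⇒false i∉S)) , trans (sumOver-restrict-⊆ S S x (λ i∈ → i∈)) xS) ,
    λ U (U⊆S , (i , i∈U) , U≢S) x|U≡0 →
      x-off U ((λ _ → ∈⊤) , (i , i∈U) , (λ { refl → x∈∁p⇒x∉p j∉S (U⊆S ∈⊤) })) U≢S
        (λ { refl → x∈∁p⇒x∉p i∈U (U⊆S i∈U) })
        (trans (sym (sumOver-restrict-⊆ U S x U⊆S)) x|U≡0)

  -- The chamber of x|_S over S lies in σ^∨_{F|_S} iff x|_S has nonnegative sums over
  -- all prefixes of F (which meet S in the prefixes of F|_S).
  restrictedChamber-InCone : (F : List (Subset n)) → IsComposition ⊤ F →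
    (S : Subset n) → Nonempty (∁ S) → (x : Vect n) → FacePoint ⊤ S x →
    ChamberInCone S (restrictC S F) (restrictV S x) ⇔ Prefix≥0 F (restrictV S x)
  restrictedChamber-InCone {n} F composition S neT x face = mk⇔ to from
    where
    FS : List (Subset n)
    FS = restrictC S F
    xS : Vect n
    xS = restrictV S x
    nonemptyS : All Nonempty FS
    nonemptyS = proj₁ (restrictC-composition S F composition)
    disjointS : AllPairs Disjoint FS
    disjointS = proj₁ (proj₂ (restrictC-composition S F composition))
    ⋃FS≡S : ∀ i → lookup (⋃ FS) i ≡ lookup S i
    ⋃FS≡S = proj₂ (proj₂ (restrictC-composition S F composition))
    to : ChamberInCone S FS xS → Prefix≥0 F xS
    to x∈cone k = let (k' , e) = Prefix-restrictC⁺ S F k in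
      ≤-trans (InCone⇒Prefix≥0 FS disjointS xS (x∈cone xS (SameChamber-refl S xS (restrictV-generic S neT x face))) k')
              (≤-reflexive (sumOver-∩-restrict (Prefix FS k') (Prefix F k) S e x))
    from : Prefix≥0 F xS → ChamberInCone S FS xS
    from x-prefix≥0 h' (_ , ((h'-support , h'S) , _) , same) =
      Prefix≥0⇒InCone FS nonemptyS disjointS h'
        (λ i i∉ → h'-support i λ i∈S → i∉ (true⇒∈ (trans (⋃FS≡S i) (∈⇒true i∈S))))
        (trans (sym (sumOver-support S h' h'-support)) h'S)
        h'-prefix≥0
      where
      h'-prefix≥0 : Prefix≥0 FS h'
      h'-prefix≥0 k' with Prefix-restrictC⁻ S F k'
      ... | k , e = subst (0ℚ ≤_) (sym (sumOver-≐ (Prefix FS k') W (λ i → trans (e i) (sym (lookup-∩ U S i))) h')) W≥0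
        where
        U : Subset n
        U = Prefix F k
        W : Subset n
        W = U ∩ S
        W≥0 : 0ℚ ≤ sumOver W h'
        W≥0 with nonempty? W | W ≟ₛ S
        ... | no ¬ne | _      = ≤-reflexive (sym (sumOver-empty W h' ¬ne))
        ... | yes _  | yes W≡S = subst (λ V → 0ℚ ≤ sumOver V h') (sym W≡S) (≤-reflexive (sym h'S))
        ... | yes ne | no W≢S = SameSign-≥0
          (≤-trans (x-prefix≥0 k) (≤-reflexive (sym (sumOver-∩-restrict W U S (lookup-∩ U S) x))))
          (same W ((λ i∈ → proj₂ (x∈p∩q⁻ U S i∈)) , ne , W≢S))

  indicator-unique : ∀ {P Q : Set} {v w} → IsIndicator P v → IsIndicator Q w → P ⇔ Q → v ≡ w
  indicator-unique (inj₁ (_ , refl)) (inj₁ (_ , refl)) _   = refl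
  indicator-unique (inj₁ (p , _))    (inj₂ (¬q , _))    P⇔Q = ⊥-elim (¬q (Equivalence.to P⇔Q p))
  indicator-unique (inj₂ (¬p , _))   (inj₁ (q , _))     P⇔Q = ⊥-elim (¬p (Equivalence.from P⇔Q q))
  indicator-unique (inj₂ (_ , refl)) (inj₂ (_ , refl)) _   = refl

  indicator-absent : ∀ {P : Set} {v} → IsIndicator P v → ¬ P → v ≡ ℤ.+ 0
  indicator-absent (inj₁ (p , _)) ¬p = ⊥-elim (¬p p)
  indicator-absent (inj₂ (_ , v≡0)) _ = v≡0

  indicator-× : ∀ {P Q : Set} {a b} → IsIndicator P a → IsIndicator Q b → IsIndicator (P × Q) (a ℤ.* b)
  indicator-× (inj₁ (p , refl)) (inj₁ (q , refl)) = inj₁ ((p , q) , refl)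
  indicator-× (inj₁ (_ , refl)) (inj₂ (¬q , refl)) = inj₂ ((λ (_ , q) → ¬q q) , refl)
  indicator-× (inj₂ (¬p , refl)) _                 = inj₂ ((λ (p , _) → ¬p p) , refl)

  -- S and ∁S, both nonempty, cannot both be initial unions of lumps: prefixes are nested.
  not-both-initial : (F : List (Subset n)) (S : Subset n) → Nonempty S → Nonempty (∁ S) →
    InitialSeg F S → InitialSeg F (∁ S) → Data.Empty.⊥
  not-both-initial F S (i , i∈S) (j , j∈T) (m , _ , Fm≡S) (m' , _ , Fm'≡T) with ℕₚ.≤-total m m'
  ... | inj₁ m≤m' = x∈∁p⇒x∉p (subst (i ∈_) Fm'≡T (Prefix-mono F m≤m' (subst (i ∈_) (sym Fm≡S) i∈S))) i∈S
  ... | inj₂ m'≤m = x∈∁p⇒x∉p j∈T (subst (j ∈_) Fm≡S (Prefix-mono F m'≤m (subst (j ∈_) (sym Fm'≡T) j∈T)))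

  -- If S is an initial union and Σ_S x = 0, then x has nonnegative prefix sums iff
  -- both x|_S and x|_∁S do: a prefix either lies in S (where x|_∁S vanishes) or
  -- contains S (where x|_S contributes Σ_S x = 0).
  Prefix≥0-split : (F : List (Subset n)) (S : Subset n) (x : Vect n) → sumOver S x ≡ 0ℚ → InitialSeg F S →
    Prefix≥0 F x ⇔ (Prefix≥0 F (restrictV S x) × Prefix≥0 F (restrictV (∁ S) x))
  Prefix≥0-split {n} F S x xS (m , _ , Fm≡S) = mk⇔ split merge
    where
    merge : Prefix≥0 F (restrictV S x) × Prefix≥0 F (restrictV (∁ S) x) → Prefix≥0 F x
    merge (onS , onT) k = ≤-trans (+-mono-≤ (onS k) (onT k)) (≤-reflexive (sym (sumOver-split (Prefix F k) S x)))
    split : Prefix≥0 F x → Prefix≥0 F (restrictV S x) × Prefix≥0 F (restrictV (∁ S) x)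
    split x-prefix≥0 = (λ k → proj₁ (both k)) , (λ k → proj₂ (both k))
      where
      both : ∀ k → 0ℚ ≤ sumOver (Prefix F k) (restrictV S x) × 0ℚ ≤ sumOver (Prefix F k) (restrictV (∁ S) x)
      both k with ℕₚ.≤-total k m
      ... | inj₁ k≤m =
        ≤-trans (x-prefix≥0 k) (≤-reflexive (sym (sumOver-restrict-⊆ U S x U⊆S))) ,
        ≤-reflexive (sym (sumOver-restrict-∁ U S x U⊆S))
        where
        U : Subset n
        U = Prefix F k
        U⊆S : U ⊆ S
        U⊆S i∈ = subst (_ ∈_) Fm≡S (Prefix-mono F k≤m i∈)
      ... | inj₂ m≤k =
        ≤-reflexive (sym (trans (sumOver-restrict-⊇ U S x S⊆U) xS)) ,
        ≤-trans (x-prefix≥0 k) (≤-reflexive (trans (sumOver-split U S x)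
          (trans (cong (_+ sumOver U (restrictV (∁ S) x)) (trans (sumOver-restrict-⊇ U S x S⊆U) xS)) (+-identityˡ _))))
        where
        U : Subset n
        U = Prefix F k
        S⊆U : S ⊆ U
        S⊆U i∈ = Prefix-mono F m≤k (subst (_ ∈_) (sym Fm≡S) i∈)

  facePoint-∁ : (S : Subset n) (x : Vect n) → FacePoint ⊤ S x → FacePoint ⊤ (∁ S) x
  facePoint-∁ S x ((x-support , x⊤) , xS , x-off) =
    (x-support , x⊤) ,
    trans (sumOver-∁ S x (trans (sym (sumOver-⊤ x)) x⊤)) (cong -_ xS) ,
    λ U p U≢T U≢S → x-off U p (λ U≡S → U≢S (trans U≡S (sym (∁-involutive S)))) U≢T

  -- T is given together with T ≡ ∁S and S ≡ ∁T,
  -- so that the same statements apply on the other side of the face with S and T swapped.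
  module ChamberAboveFace {n : ℕ} (F : List (Subset n)) (composition : IsComposition ⊤ F)
    (S T : Subset n) (T≡∁S : T ≡ ∁ S) (S≡∁T : S ≡ ∁ T) (neS : Nonempty S) (neT : Nonempty T)
    (x : Vect n) (faceS : FacePoint ⊤ S x) (h : Vect n) (above : ChamberAbove ⊤ S x h) where

    faceT : FacePoint ⊤ T x
    faceT = subst (λ V → FacePoint ⊤ V x) (sym T≡∁S) (facePoint-∁ S x faceS)

    cone⇔ : ChamberInCone ⊤ F h ⇔ (¬ InitialSeg F T × Prefix≥0 F x)
    cone⇔ = subst (λ V → ChamberInCone ⊤ F h ⇔ (¬ InitialSeg F V × Prefix≥0 F x)) (sym T≡∁S)
      (chamberAbove-InCone F composition S neS (subst Nonempty T≡∁S neT) x faceS h above)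

    cone-T-not-initial : ¬ InitialSeg F T → ChamberInCone ⊤ F h ⇔ Prefix≥0 F x
    cone-T-not-initial T-not-initial = mk⇔ proj₂ (T-not-initial ,_) ⇔-∘ cone⇔

    value-T-initial : ∀ {v} → IsIndicator (ChamberInCone ⊤ F h) v → InitialSeg F T → v ≡ ℤ.+ 0
    value-T-initial iv T-initial = indicator-absent iv λ h∈cone → proj₁ (Equivalence.to cone⇔ h∈cone) T-initial

    value-S-initial : ∀ {v a b} → IsIndicator (ChamberInCone ⊤ F h) v →
      IsIndicator (ChamberInCone S (restrictC S F) (restrictV S x)) a →
      IsIndicator (ChamberInCone T (restrictC T F) (restrictV T x)) b →
      InitialSeg F S → v ≡ a ℤ.* b
    value-S-initial iv ia ib S-initial = indicator-unique iv (indicator-× ia ib)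
      (⇔-sym (restrictedS ×-⇔ restrictedT) ⇔-∘ (split ⇔-∘ cone-T-not-initial T-not-initial))
      where
      T-not-initial : ¬ InitialSeg F T
      T-not-initial T-initial = not-both-initial F S neS (subst Nonempty T≡∁S neT) S-initial
                                  (subst (InitialSeg F) T≡∁S T-initial)
      split : Prefix≥0 F x ⇔ (Prefix≥0 F (restrictV S x) × Prefix≥0 F (restrictV T x))
      split = subst (λ V → Prefix≥0 F x ⇔ (Prefix≥0 F (restrictV S x) × Prefix≥0 F (restrictV V x))) (sym T≡∁S)
        (Prefix≥0-split F S x (proj₁ (proj₂ faceS)) S-initial)
      restrictedS : ChamberInCone S (restrictC S F) (restrictV S x) ⇔ Prefix≥0 F (restrictV S x)
      restrictedS = restrictedChamber-InCone F composition S (subst Nonempty T≡∁S neT) x faceS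
      restrictedT : ChamberInCone T (restrictC T F) (restrictV T x) ⇔ Prefix≥0 F (restrictV T x)
      restrictedT = restrictedChamber-InCone F composition T (subst Nonempty S≡∁T neS) x faceT

open Lemmas
open import Data.Integer using (ℤ; _-_; _*_)
import Data.Integer.Properties as ℤₚ

mainTheorem9 : ∀ {n : ℕ} (F : List (Subset n)) → IsComposition ⊤ F →
    (S : Subset n) → Nonempty S → Nonempty (∁ S) →
    (x : Vect n) → FacePoint ⊤ S x →
    (hST hTS : Vect n) → ChamberAbove ⊤ S x hST → ChamberAbove ⊤ (∁ S) x hTS →
    (vST vTS a b δS δT : ℤ) →
    IsIndicator (ChamberInCone ⊤ F hST) vST →
    IsIndicator (ChamberInCone ⊤ F hTS) vTS →
    IsIndicator (ChamberInCone S (restrictC S F) (restrictV S x)) a →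
    IsIndicator (ChamberInCone (∁ S) (restrictC (∁ S) F) (restrictV (∁ S) x)) b →
    IsIndicator (InitialSeg F S) δS →
    IsIndicator (InitialSeg F (∁ S)) δT →
    vST - vTS ≡ a * b * δS - b * a * δT
mainTheorem9 F composition S neS neT x face hST hTS aboveS aboveT vST vTS a b δS δT iST iTS ia ib iδS iδT =
  by-cases iδS iδT
  where
  module Above = ChamberAboveFace F composition S (∁ S) refl (sym (∁-involutive S)) neS neT x face hST aboveS
  module Below = ChamberAboveFace F composition (∁ S) S (sym (∁-involutive S)) refl neT neS x (facePoint-∁ S x face) hTS aboveT
  by-cases : IsIndicator (InitialSeg F S) δS → IsIndicator (InitialSeg F (∁ S)) δT → vST - vTS ≡ a * b * δS - b * a * δT
  by-cases (inj₁ (S-initial , _)) (inj₁ (T-initial , _)) = ⊥-elim (not-both-initial F S neS neT S-initial T-initial)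
  by-cases (inj₁ (S-initial , refl)) (inj₂ (_ , refl)) =
    trans (cong₂ _-_ (Above.value-S-initial iST ia ib S-initial) (Below.value-T-initial iTS S-initial))
          (cong₂ _-_ (sym (ℤₚ.*-identityʳ (a * b))) (sym (ℤₚ.*-zeroʳ (b * a))))
  by-cases (inj₂ (_ , refl)) (inj₁ (T-initial , refl)) =
    trans (cong₂ _-_ (Above.value-T-initial iST T-initial) (Below.value-S-initial iTS ib ia T-initial))
          (cong₂ _-_ (sym (ℤₚ.*-zeroʳ (a * b))) (sym (ℤₚ.*-identityʳ (b * a))))
  by-cases (inj₂ (S-not-initial , refl)) (inj₂ (T-not-initial , refl)) =
    trans (cong (_- vTS) (indicator-unique iST iTS
            (⇔-sym (Below.cone-T-not-initial S-not-initial) ⇔-∘ Above.cone-T-not-initial T-not-initial)))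
          (trans (ℤₚ.+-inverseʳ vTS) (sym (cong₂ _-_ (ℤₚ.*-zeroʳ (a * b)) (ℤₚ.*-zeroʳ (b * a)))))
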